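{- Let $p\ge 5$ be a prime. For every integer $j$ with $0<j<p$, $$\sum_{k=0}^{p-1}T(k,j)\equiv \frac{(-1)^j+1}{2}\cdot(-1)^{\frac{p-j-1}{2}}\pmod{p}$$ (so the right-hand side is $0$ when $j$ is odd and $(-1)^{(p-j-1)/2}$ when $j$ is even). Moreover, $$\sum_{m=0}^{p-1}\sum_{n=0}^{p-1}T(m,n)\equiv \frac{1}{2}\left((-1)^{\frac{p-1}{2}}+1\right)\pmod{p}.$$
   Context: For an integer $n\ge 0$ and an integer $j$, the trinomial coefficient $T(n,j)$ is the coefficient of $x^j$ in the Laurent polynomial $(1+x+x^{ -1})^n$, i.e. $(1+x+x^{ -1})^n=\sum_{j=-n}^{n}T(n,j)x^j$ (and $T(n,j)=0$ for $|j|>n$). Congruences between rationals are understood in the ring of rationals with denominators prime to $p$. -}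

module Defs where

open import Data.Nat as ℕ using (ℕ; zero; suc)
open import Data.Integer as ℤ using (ℤ; +_; -[1+_])
open import Data.Integer.Divisibility using (_∣_)
open import Data.Rational as ℚ using (ℚ; ↥_; ↧_)
open import Data.Product using (_×_)
open import Relation.Nullary using (¬_)

-- Trinomial coefficient T(n,j) = coefficient of x^j in (1 + x + x⁻¹)^n,
-- computed by expanding (1+x+x⁻¹)^(n+1) = (1+x+x⁻¹)^n · (x⁻¹ + 1 + x):
-- (1+x+x⁻¹)^0 = 1 and  T(n+1,j) = T(n,j-1) + T(n,j) + T(n,j+1).
T : ℕ → ℤ → ℤ
T zero (+ zero)  = + 1
T zero (+ suc _) = + 0
T zero -[1+ _ ]  = + 0
T (suc n) j = T n (j ℤ.- + 1) ℤ.+ T n j ℤ.+ T n (j ℤ.+ + 1)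

Σ< : ℕ → (ℕ → ℤ) → ℤ
Σ< zero    f = + 0
Σ< (suc n) f = Σ< n f ℤ.+ f n

toℚ : ℤ → ℚ
toℚ z = z ℚ./ 1

-- Congruence a ≡ b (mod p) in the ring ℤ_(p) of rationals with denominators
-- prime to p: both a and b have denominators prime to p, and p divides
-- the numerator of the (reduced) difference a - b.
_≡_[modℚ_] : ℚ → ℚ → ℕ → Set
a ≡ b [modℚ p ] = ¬ (+ p ∣ ↧ a) × ¬ (+ p ∣ ↧ b) × (+ p ∣ ↥ (a ℚ.- b))

module Submission where

-- Write S(j) = Σ_{k<p} T(k,j) for the j-th column sum.  Summing the
-- recurrence T(k+1,j+1) = T(k,j) + T(k,j+1) + T(k,j+2) over k < p telescopes
-- to  S(j) + S(j+2) = T(p,j+1).  The derivative of (1+x+x⁻¹)^(n+1) gives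
-- j·T(n+1,j) = (n+1)·(T(n,j-1) - T(n,j+1)), so p ∣ T(p,j) for 0 < j < p.
-- Hence S(j) ≡ -S(j+2) (mod p) for j+1 < p.  Since T(k,j) = 0 for k < j and
-- T(n,n) = 1, the top of the column is S(p) = 0 and S(p-1) = 1; descending
-- from there, S(p-1-i) ≡ w(i) with the "wave" w = 1, 0, -1, 0, 1, 0, ...
--
-- For the second claim the double sum is Σ_{j<p} S(j) ≡ Σ_{i<p} w(i), and
-- twice the partial sums of w over an odd range are (-1)^q + 1.  Finally the
-- integer congruences are transported to ℤ_(p) ⊆ ℚ, where the halved
-- right-hand sides of the theorem are exactly these integers.

open import Defs
open import Data.Nat as ℕ using (ℕ; zero; suc; _≤_; _<_; _∸_; z≤n; s≤s)
import Data.Nat.Properties as ℕP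
open import Data.Nat.DivMod using (m*n/n≡m; m/n≡1+[m∸n]/n)
import Data.Nat.Divisibility as ℕD
import Data.Nat.Coprimality as Coprimality
open import Data.Nat.Primality using (Prime; euclidsLemma; prime⇒irreducible)
open import Data.Integer as ℤ using (ℤ; +_; -[1+_]; _+_; _-_; _*_; -_)
import Data.Integer.Properties as ℤP
import Data.Integer.Divisibility as Unsigned
open import Data.Integer.Divisibility.Signed
  using (_∣_; divides; ∣ᵤ⇒∣; ∣⇒∣ᵤ; ∣m∣n⇒∣m+n; ∣m⇒∣-m)
open import Data.Integer.Tactic.RingSolver using (solve-∀)
open import Data.Rational as ℚ using (ℚ; mkℚ; ↥_; ↧_)
import Data.Rational.Properties as ℚP
open import Data.Rational.Unnormalised using (mkℚᵘ; *≡*)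
open import Data.Product using (_×_; _,_; ∃)
open import Data.Sum using (_⊎_; inj₁; inj₂)
open import Relation.Nullary using (¬_; contradiction)
open import Relation.Binary.PropositionalEquality
open ≡-Reasoning

Σ<-+ : ∀ n (f g : ℕ → ℤ) → Σ< n (λ k → f k + g k) ≡ Σ< n f + Σ< n g
Σ<-+ zero    f g = refl
Σ<-+ (suc n) f g = begin
  Σ< n (λ k → f k + g k) + (f n + g n)  ≡⟨ cong (_+ (f n + g n)) (Σ<-+ n f g) ⟩
  Σ< n f + Σ< n g + (f n + g n)         ≡⟨ interchange (Σ< n f) (Σ< n g) (f n) (g n) ⟩
  Σ< n f + f n + (Σ< n g + g n)         ∎
  where
  interchange : ∀ a b c d → a + b + (c + d) ≡ a + c + (b + d)
  interchange = solve-∀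

Σ<-zero : ∀ n → Σ< n (λ _ → + 0) ≡ + 0
Σ<-zero zero    = refl
Σ<-zero (suc n) = cong (_+ + 0) (Σ<-zero n)

Σ<-swap : ∀ a b (f : ℕ → ℕ → ℤ) →
          Σ< a (λ m → Σ< b (λ n → f m n)) ≡ Σ< b (λ n → Σ< a (λ m → f m n))
Σ<-swap zero    b f = sym (Σ<-zero b)
Σ<-swap (suc a) b f = begin
  Σ< a (λ m → Σ< b (f m)) + Σ< b (f a)  ≡⟨ cong (_+ Σ< b (f a)) (Σ<-swap a b f) ⟩
  Σ< b (λ n → Σ< a (λ m → f m n)) + Σ< b (f a)
    ≡⟨ Σ<-+ b (λ n → Σ< a (λ m → f m n)) (f a) ⟨
  Σ< b (λ n → Σ< a (λ m → f m n) + f a n) ∎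

Σ<-cong : ∀ n {f g : ℕ → ℤ} → (∀ k → k < n → f k ≡ g k) → Σ< n f ≡ Σ< n g
Σ<-cong zero    eq = refl
Σ<-cong (suc n) eq =
  cong₂ _+_ (Σ<-cong n (λ k k<n → eq k (ℕP.m<n⇒m<1+n k<n))) (eq n ℕP.≤-refl)

Σ<-peel : ∀ n (f : ℕ → ℤ) → Σ< (suc n) f ≡ f 0 + Σ< n (λ k → f (suc k))
Σ<-peel zero    f = ℤP.+-comm (+ 0) (f 0)
Σ<-peel (suc n) f = begin
  Σ< (suc n) f + f (suc n)                     ≡⟨ cong (_+ f (suc n)) (Σ<-peel n f) ⟩
  f 0 + Σ< n (λ k → f (suc k)) + f (suc n)     ≡⟨ ℤP.+-assoc (f 0) _ (f (suc n)) ⟩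
  f 0 + (Σ< n (λ k → f (suc k)) + f (suc n))   ∎

Σ<-neg : ∀ n (f : ℕ → ℤ) → Σ< n (λ k → - f k) ≡ - Σ< n f
Σ<-neg zero    f = refl
Σ<-neg (suc n) f = begin
  Σ< n (λ k → - f k) + - f n  ≡⟨ cong (_+ - f n) (Σ<-neg n f) ⟩
  - Σ< n f + - f n            ≡⟨ ℤP.neg-distrib-+ (Σ< n f) (f n) ⟨
  - (Σ< n f + f n)            ∎

Σ<-reverse : ∀ n (f : ℕ → ℤ) → Σ< (suc n) (λ k → f (n ∸ k)) ≡ Σ< (suc n) f
Σ<-reverse zero    f = refl
Σ<-reverse (suc n) f = begin
  Σ< (suc n) (λ k → f (suc n ∸ k)) + f (suc n ∸ suc n)
    ≡⟨ cong₂ _+_ (Σ<-cong (suc n) shift) (cong f (ℕP.n∸n≡0 n)) ⟩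
  Σ< (suc n) (λ k → f (suc (n ∸ k))) + f 0  ≡⟨ cong (_+ f 0) (Σ<-reverse n (λ k → f (suc k))) ⟩
  Σ< (suc n) (λ k → f (suc k)) + f 0        ≡⟨ ℤP.+-comm _ (f 0) ⟩
  f 0 + Σ< (suc n) (λ k → f (suc k))        ≡⟨ Σ<-peel (suc n) f ⟨
  Σ< (suc (suc n)) f                        ∎
  where
  shift : ∀ k → k < suc n → f (suc n ∸ k) ≡ f (suc (n ∸ k))
  shift k k<1+n = cong f (ℕP.+-∸-assoc 1 (ℕP.≤-pred k<1+n))

-- Congruence of integers modulo a natural number: p divides the difference.
-- (A record rather than a bare definition, so that a and b can be inferred.)
infix 4 _≡_[mod_]

record _≡_[mod_] (a b : ℤ) (p : ℕ) : Set where
  constructor divides-difference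
  field
    difference-divisible : + p ∣ a - b

open _≡_[mod_] using (difference-divisible)

≡⇒≡-mod : ∀ {a b p} → a ≡ b → a ≡ b [mod p ]
≡⇒≡-mod {a} {p = p} refl =
  divides-difference (subst (+ p ∣_) (sym (ℤP.+-inverseʳ a)) (divides (+ 0) refl))

≡-mod-trans : ∀ {a b c p} → a ≡ b [mod p ] → b ≡ c [mod p ] → a ≡ c [mod p ]
≡-mod-trans {a} {b} {c} {p} (divides-difference ab) (divides-difference bc) =
  divides-difference (subst (+ p ∣_) (split a b c) (∣m∣n⇒∣m+n ab bc))
  where
  split : ∀ a b c → (a - b) + (b - c) ≡ a - c
  split = solve-∀

≡-mod-neg : ∀ {a b p} → a ≡ b [mod p ] → - a ≡ - b [mod p ]
≡-mod-neg {a} {b} {p} (divides-difference ab) =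
  divides-difference (subst (+ p ∣_) (negate a b) (∣m⇒∣-m ab))
  where
  negate : ∀ a b → - (a - b) ≡ - a - - b
  negate = solve-∀

≡-mod-Σ : ∀ {p} n {f g : ℕ → ℤ} → (∀ k → k < n → f k ≡ g k [mod p ]) →
          Σ< n f ≡ Σ< n g [mod p ]
≡-mod-Σ zero    fg = ≡⇒≡-mod refl
≡-mod-Σ {p} (suc n) {f} {g} fg =
  divides-difference (subst (+ p ∣_) (regroup (Σ< n f) (Σ< n g) (f n) (g n))
    (∣m∣n⇒∣m+n (difference-divisible (≡-mod-Σ n (λ k k<n → fg k (ℕP.m<n⇒m<1+n k<n))))
               (difference-divisible (fg n ℕP.≤-refl))))
  where
  regroup : ∀ a b c d → (a - b) + (c - d) ≡ (a + c) - (b + d)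
  regroup = solve-∀

T-step : ∀ k j → T (suc k) (+ suc j) ≡ T k (+ j) + T k (+ suc j) + T k (+ suc (suc j))
T-step k j = cong (λ i → T k (+ j) + T k (+ suc j) + T k (+ i)) (ℕP.+-comm (suc j) 1)

-- T(k,m) = 0 for k < m: the degree of (1+x+x⁻¹)^k is k.
T-vanish : ∀ k m → k < m → T k (+ m) ≡ + 0
T-vanish zero    (suc m) _         = refl
T-vanish (suc k) (suc m) (s≤s k<m)
  rewrite T-step k m
        | T-vanish k m k<m
        | T-vanish k (suc m) (ℕP.m<n⇒m<1+n k<m)
        | T-vanish k (suc (suc m)) (ℕP.m<n⇒m<1+n (ℕP.m<n⇒m<1+n k<m)) = refl

-- T(n,n) = 1: the leading coefficient.
T-diagonal : ∀ n → T n (+ n) ≡ + 1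
T-diagonal zero = refl
T-diagonal (suc n)
  rewrite T-step n n
        | T-diagonal n
        | T-vanish n (suc n) ℕP.≤-refl
        | T-vanish n (suc (suc n)) (ℕP.m<n⇒m<1+n ℕP.≤-refl) = refl

Δ : ℕ → ℤ → ℤ
Δ n j = T n (j - + 1) - T n (j + + 1)

Δ-step : ∀ n j → Δ (suc n) j ≡ Δ n (j - + 1) + Δ n j + Δ n (j + + 1)
Δ-step n j = begin
  (u + v + T n (j - + 1 + + 1)) - (T n (j + + 1 - + 1) + x + y)
    ≡⟨ cong₂ (λ a b → (u + v + T n a) - (T n b + x + y)) (down-up j) (up-down j) ⟩
  (u + v + w) - (w + x + y)
    ≡⟨ regroup u v w x y ⟩
  (u - w) + (v - x) + (w - y)
    ≡⟨ cong₂ (λ a b → (u - T n a) + (v - x) + (T n b - y)) (down-up j) (up-down j) ⟨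
  Δ n (j - + 1) + Δ n j + Δ n (j + + 1)
    ∎
  where
  u = T n (j - + 1 - + 1)
  v = T n (j - + 1)
  w = T n j
  x = T n (j + + 1)
  y = T n (j + + 1 + + 1)
  down-up : ∀ j → j - + 1 + + 1 ≡ j
  down-up = solve-∀
  up-down : ∀ j → j + + 1 - + 1 ≡ j
  up-down = solve-∀
  regroup : ∀ u v w x y → (u + v + w) - (w + x + y) ≡ (u - w) + (v - x) + (w - y)
  regroup = solve-∀

-- Comparing coefficients in the derivative identity
--   x·d/dx (1+x+x⁻¹)^(n+1) = (n+1)·(x - x⁻¹)·(1+x+x⁻¹)^n.
T-derivative : ∀ n j → j * T (suc n) j ≡ + suc n * Δ n j
T-derivative zero (+ zero)          = refl
T-derivative zero (+ suc zero)      = refl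
T-derivative zero (+ suc (suc k))   = ℤP.*-zeroʳ (+ suc (suc k))
T-derivative zero -[1+ zero ]       = refl
T-derivative zero -[1+ suc k ]      = ℤP.*-zeroʳ -[1+ suc k ]
T-derivative (suc n) j = begin
  j * (a + b + c)
    ≡⟨ spread j a b c ⟩
  (j - + 1) * a + j * b + (j + + 1) * c + (a - c)
    ≡⟨ cong₂ (λ s t → s + j * b + t + (a - c)) (T-derivative n (j - + 1)) (T-derivative n (j + + 1)) ⟩
  N * Δ n (j - + 1) + j * b + N * Δ n (j + + 1) + (a - c)
    ≡⟨ cong (λ s → N * Δ n (j - + 1) + s + N * Δ n (j + + 1) + (a - c)) (T-derivative n j) ⟩
  N * Δ n (j - + 1) + N * Δ n j + N * Δ n (j + + 1) + Δ (suc n) j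
    ≡⟨ factor N (Δ n (j - + 1)) (Δ n j) (Δ n (j + + 1)) (Δ (suc n) j) ⟩
  N * (Δ n (j - + 1) + Δ n j + Δ n (j + + 1)) + Δ (suc n) j
    ≡⟨ cong (λ s → N * s + Δ (suc n) j) (Δ-step n j) ⟨
  N * Δ (suc n) j + Δ (suc n) j
    ≡⟨ one-more N (Δ (suc n) j) ⟩
  (+ 1 + N) * Δ (suc n) j
    ∎
  where
  N = + suc n
  a = T (suc n) (j - + 1)
  b = T (suc n) j
  c = T (suc n) (j + + 1)
  spread : ∀ j a b c → j * (a + b + c) ≡ (j - + 1) * a + j * b + (j + + 1) * c + (a - c)
  spread = solve-∀
  factor : ∀ N d e f g → N * d + N * e + N * f + g ≡ N * (d + e + f) + g
  factor = solve-∀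
  one-more : ∀ N d → N * d + d ≡ (+ 1 + N) * d
  one-more = solve-∀

-- For a prime p and 0 < j < p, the prime p divides T(p,j), because
-- j·T(p,j) = p·Δ(p-1,j) and p does not divide j.
T-prime-row : ∀ {p} → Prime p → ∀ j → 0 < j → j < p → + p ∣ T p (+ j)
T-prime-row {suc n} p-prime j 0<j j<p = ∣ᵤ⇒∣ p∣T
  where
  p∣jT : suc n ℕD.∣ j ℕ.* ℤ.∣ T (suc n) (+ j) ∣
  p∣jT = subst (suc n ℕD.∣_) (ℤP.abs-* (+ j) (T (suc n) (+ j)))
           (∣⇒∣ᵤ (divides (Δ n (+ j)) (trans (T-derivative n (+ j)) (ℤP.*-comm (+ suc n) (Δ n (+ j))))))
  p∣T : suc n ℕD.∣ ℤ.∣ T (suc n) (+ j) ∣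
  p∣T with euclidsLemma j _ p-prime p∣jT
  ... | inj₁ p∣j = contradiction (ℕD.∣⇒≤ {{ℕ.>-nonZero 0<j}} p∣j) (ℕP.<⇒≱ j<p)
  ... | inj₂ p∣T = p∣T

column : ℕ → ℕ → ℤ
column N j = Σ< N (λ k → T k (+ j))

-- Summing the recurrence of T over the rows telescopes.
column-recurrence : ∀ N j → column N j + column N (suc (suc j)) ≡ T N (+ suc j)
column-recurrence zero    j = refl
column-recurrence (suc N) j = begin
  (column N j + a) + (column N (suc (suc j)) + c)   ≡⟨ interchange (column N j) a _ c ⟩
  (column N j + column N (suc (suc j))) + (a + c)   ≡⟨ cong (_+ (a + c)) (column-recurrence N j) ⟩
  T N (+ suc j) + (a + c)                           ≡⟨ rotate (T N (+ suc j)) a c ⟩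
  a + T N (+ suc j) + c                             ≡⟨ T-step N j ⟨
  T (suc N) (+ suc j)                               ∎
  where
  a = T N (+ j)
  c = T N (+ suc (suc j))
  interchange : ∀ x a y c → (x + a) + (y + c) ≡ (x + y) + (a + c)
  interchange = solve-∀
  rotate : ∀ b a c → b + (a + c) ≡ a + b + c
  rotate = solve-∀

column-vanish : ∀ N j → N ≤ j → column N j ≡ + 0
column-vanish zero    j _   = refl
column-vanish (suc N) j N<j =
  cong₂ _+_ (column-vanish N j (ℕP.≤-trans (ℕP.n≤1+n N) N<j)) (T-vanish N j N<j)

column-top : ∀ n → column (suc n) n ≡ + 1
column-top n = begin
  column (suc n) n                                     ≡⟨ ℤP.+-identityʳ _ ⟨
  column (suc n) n + + 0                               ≡⟨ cong (_+_ (column (suc n) n)) (column-vanish (suc n) (suc (suc n)) (ℕP.n≤1+n (suc n))) ⟨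
  column (suc n) n + column (suc n) (suc (suc n))      ≡⟨ column-recurrence (suc n) n ⟩
  T (suc n) (+ suc n)                                  ≡⟨ T-diagonal (suc n) ⟩
  + 1                                                  ∎

column-reflection : ∀ {n j} → Prime (suc n) → suc j ≤ n →
  column (suc n) j ≡ - column (suc n) (suc (suc j)) [mod suc n ]
column-reflection {n} {j} p-prime j<n =
  divides-difference (subst (+ suc n ∣_) row (T-prime-row p-prime (suc j) (s≤s z≤n) (s≤s j<n)))
  where
  row : T (suc n) (+ suc j) ≡ column (suc n) j - - column (suc n) (suc (suc j))
  row = begin
    T (suc n) (+ suc j)                                   ≡⟨ column-recurrence (suc n) j ⟨
    column (suc n) j + column (suc n) (suc (suc j))       ≡⟨ cong (_+_ (column (suc n) j)) (ℤP.neg-involutive _) ⟨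
    column (suc n) j - - column (suc n) (suc (suc j))     ∎

wave : ℕ → ℤ
wave zero             = + 1
wave (suc zero)       = + 0
wave (suc (suc i))    = - wave i

column-wave : ∀ {n} → Prime (suc n) → ∀ i j → i ℕ.+ j ≡ n →
  column (suc n) j ≡ wave i [mod suc n ]
column-wave p-prime zero             j refl = ≡⇒≡-mod (column-top j)
column-wave p-prime (suc zero)       j refl =
  ≡-mod-trans (column-reflection p-prime ℕP.≤-refl)
    (≡⇒≡-mod (cong -_ (column-vanish (suc (suc j)) (suc (suc j)) ℕP.≤-refl)))
column-wave p-prime (suc (suc i))    j refl =
  ≡-mod-trans (column-reflection p-prime (s≤s (ℕP.m≤n+m j (suc i))))
    (≡-mod-neg (column-wave p-prime i (suc (suc j)) shift))
  where
  shift : i ℕ.+ suc (suc j) ≡ suc (suc (i ℕ.+ j))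
  shift = trans (ℕP.+-suc i (suc j)) (cong suc (ℕP.+-suc i j))

column-mod : ∀ {n j} → Prime (suc n) → j ≤ n → column (suc n) j ≡ wave (n ∸ j) [mod suc n ]
column-mod {n} {j} p-prime j≤n = column-wave p-prime (n ∸ j) j (ℕP.m∸n+n≡m j≤n)

total-mod : ∀ {n} → Prime (suc n) →
  Σ< (suc n) (λ m → Σ< (suc n) (λ j → T m (+ j))) ≡ Σ< (suc n) wave [mod suc n ]
total-mod {n} p-prime =
  ≡-mod-trans (≡⇒≡-mod (Σ<-swap (suc n) (suc n) (λ m j → T m (+ j))))
    (≡-mod-trans (≡-mod-Σ (suc n) (λ j j<p → column-mod p-prime (ℕP.≤-pred j<p)))
      (≡⇒≡-mod (Σ<-reverse n wave)))

alt : ℕ → ℤ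
alt k = -[1+ 0 ] ℤ.^ k

alt-square : ∀ k → alt k * alt k ≡ + 1
alt-square zero    = refl
alt-square (suc k) = trans (square (alt k)) (alt-square k)
  where
  square : ∀ a → (-[1+ 0 ] * a) * (-[1+ 0 ] * a) ≡ a * a
  square = solve-∀

alt-even : ∀ q → alt (2 ℕ.* q) ≡ + 1
alt-even q = trans (sym (ℤP.^-*-assoc -[1+ 0 ] 2 q)) (ℤP.^-zeroˡ q)

alt-parity : ∀ i j → alt (i ℕ.+ j) ≡ + 1 → alt j ≡ alt i
alt-parity i j even = begin
  alt j                        ≡⟨ ℤP.*-identityˡ (alt j) ⟨
  + 1 * alt j                  ≡⟨ cong (_* alt j) (alt-square i) ⟨
  alt i * alt i * alt j        ≡⟨ ℤP.*-assoc (alt i) (alt i) (alt j) ⟩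
  alt i * (alt i * alt j)      ≡⟨ cong (alt i *_) (ℤP.^-distribˡ-+-* -[1+ 0 ] i j) ⟨
  alt i * alt (i ℕ.+ j)        ≡⟨ cong (alt i *_) even ⟩
  alt i * + 1                  ≡⟨ ℤP.*-identityʳ (alt i) ⟩
  alt i                        ∎

wave-doubled : ∀ i → (alt i + + 1) * alt (i ℕ./ 2) ≡ + 2 * wave i
wave-doubled zero          = refl
wave-doubled (suc zero)    = refl
wave-doubled (suc (suc i)) = begin
  (alt (suc (suc i)) + + 1) * alt (suc (suc i) ℕ./ 2)
    ≡⟨ cong (λ h → (alt (suc (suc i)) + + 1) * alt h) (m/n≡1+[m∸n]/n {suc (suc i)} {2} (s≤s (s≤s z≤n))) ⟩
  (-[1+ 0 ] * (-[1+ 0 ] * alt i) + + 1) * (-[1+ 0 ] * alt (i ℕ./ 2))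
    ≡⟨ flip (alt i) (alt (i ℕ./ 2)) ⟩
  - ((alt i + + 1) * alt (i ℕ./ 2))
    ≡⟨ cong -_ (wave-doubled i) ⟩
  - (+ 2 * wave i)
    ≡⟨ ℤP.neg-distribʳ-* (+ 2) (wave i) ⟩
  + 2 * - wave i
    ∎
  where
  flip : ∀ a b → (-[1+ 0 ] * (-[1+ 0 ] * a) + + 1) * (-[1+ 0 ] * b) ≡ - ((a + + 1) * b)
  flip = solve-∀

-- Two steps of the wave negate it, so its partial sums satisfy
-- Σ_{i<k+2} w(i) = 1 - Σ_{i<k} w(i).
wave-Σ-step : ∀ k → Σ< (suc (suc k)) wave ≡ + 1 - Σ< k wave
wave-Σ-step k = begin
  Σ< (suc (suc k)) wave                          ≡⟨ Σ<-peel (suc k) wave ⟩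
  + 1 + Σ< (suc k) (λ i → wave (suc i))          ≡⟨ cong (_+_ (+ 1)) (Σ<-peel k (λ i → wave (suc i))) ⟩
  + 1 + (+ 0 + Σ< k (λ i → - wave i))            ≡⟨ cong (_+_ (+ 1)) (ℤP.+-identityˡ (Σ< k (λ i → - wave i))) ⟩
  + 1 + Σ< k (λ i → - wave i)                    ≡⟨ cong (_+_ (+ 1)) (Σ<-neg k wave) ⟩
  + 1 - Σ< k wave                                ∎

wave-sum : ∀ q → + 2 * Σ< (suc (2 ℕ.* q)) wave ≡ alt q + + 1
wave-sum zero    = refl
wave-sum (suc q) = begin
  + 2 * Σ< (suc (2 ℕ.* suc q)) wave
    ≡⟨ cong (λ m → + 2 * Σ< (suc m) wave) (ℕP.*-suc 2 q) ⟩
  + 2 * Σ< (suc (suc (suc (2 ℕ.* q)))) wave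
    ≡⟨ cong (_*_ (+ 2)) (wave-Σ-step (suc (2 ℕ.* q))) ⟩
  + 2 * (+ 1 - s)
    ≡⟨ distrib s ⟩
  + 2 - + 2 * s
    ≡⟨ cong (λ t → + 2 - t) (wave-sum q) ⟩
  + 2 - (alt q + + 1)
    ≡⟨ finish (alt q) ⟩
  -[1+ 0 ] * alt q + + 1
    ∎
  where
  s = Σ< (suc (2 ℕ.* q)) wave
  distrib : ∀ s → + 2 * (+ 1 - s) ≡ + 2 - + 2 * s
  distrib = solve-∀
  finish : ∀ a → + 2 - (a + + 1) ≡ -[1+ 0 ] * a + + 1
  finish = solve-∀

integral : ℤ → ℚ
integral a = mkℚ a 0 (Coprimality.sym (Coprimality.1-coprimeTo ℤ.∣ a ∣))

toℚ-integral : ∀ a → toℚ a ≡ integral a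
toℚ-integral a = ℚP.↥p/↧p≡p (integral a)

integral-neg : ∀ a → ℚ.- integral a ≡ integral (- a)
integral-neg (+ zero)  = refl
integral-neg (+ suc n) = refl
integral-neg -[1+ n ]  = refl

toℚ-difference : ∀ a b → toℚ a ℚ.- toℚ b ≡ toℚ (a - b)
toℚ-difference a b = begin
  toℚ a ℚ.- toℚ b                  ≡⟨ cong₂ (λ x y → x ℚ.+ ℚ.- y) (toℚ-integral a) (toℚ-integral b) ⟩
  integral a ℚ.+ ℚ.- integral b    ≡⟨ cong (integral a ℚ.+_) (integral-neg b) ⟩
  integral a ℚ.+ integral (- b)    ≡⟨⟩
  toℚ (a * + 1 + - b * + 1)        ≡⟨ cong toℚ (unit a (- b)) ⟩
  toℚ (a - b)                      ∎
  where
  unit : ∀ a c → a * + 1 + c * + 1 ≡ a + c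
  unit = solve-∀

-- An integer congruence modulo p > 1 is a congruence in ℤ_(p): integers
-- have denominator 1, and the numerator of the difference is the difference.
toℚ-congruence : ∀ {p a b} → 1 < p → a ≡ b [mod p ] → toℚ a ≡ toℚ b [modℚ p ]
toℚ-congruence {p} {a} {b} 1<p (divides-difference p∣a-b) =
  unit-denominator a , unit-denominator b ,
  ∣⇒∣ᵤ (subst (+ p ∣_) (sym (cong ↥_ (trans (toℚ-difference a b) (toℚ-integral (a - b))))) p∣a-b)
  where
  unit-denominator : ∀ c → ¬ (+ p Unsigned.∣ ↧ toℚ c)
  unit-denominator c p∣ =
    ℕP.<⇒≢ 1<p (sym (ℕD.∣1⇒≡1 (subst (λ r → p ℕD.∣ ℤ.∣ ↧ r ∣) (toℚ-integral c) p∣)))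

toℚ-half : ∀ y → (+ 2 * y) ℚ./ 2 ≡ toℚ y
toℚ-half y = ℚP.fromℚᵘ-cong {mkℚᵘ (+ 2 * y) 1} {mkℚᵘ y 0} (*≡* (cross y))
  where
  cross : ∀ y → (+ 2 * y) * + 1 ≡ y * + 2
  cross = solve-∀

expected-column : ∀ q j → j ≤ 2 ℕ.* q →
  ((alt j + + 1) * alt ((suc (2 ℕ.* q) ∸ j ∸ 1) ℕ./ 2)) ℚ./ 2 ≡ toℚ (wave (2 ℕ.* q ∸ j))
expected-column q j j≤2q = begin
  ((alt j + + 1) * alt ((suc (2 ℕ.* q) ∸ j ∸ 1) ℕ./ 2)) ℚ./ 2
    ≡⟨ cong₂ (λ s m → ((s + + 1) * alt (m ℕ./ 2)) ℚ./ 2) same-sign index ⟩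
  ((alt i + + 1) * alt (i ℕ./ 2)) ℚ./ 2
    ≡⟨ cong (λ z → z ℚ./ 2) (wave-doubled i) ⟩
  (+ 2 * wave i) ℚ./ 2
    ≡⟨ toℚ-half (wave i) ⟩
  toℚ (wave i)
    ∎
  where
  i = 2 ℕ.* q ∸ j
  index : suc (2 ℕ.* q) ∸ j ∸ 1 ≡ i
  index = trans (ℕP.∸-+-assoc (suc (2 ℕ.* q)) j 1) (cong (suc (2 ℕ.* q) ∸_) (ℕP.+-comm j 1))
  same-sign : alt j ≡ alt i
  same-sign = alt-parity i j (trans (cong alt (ℕP.m∸n+n≡m j≤2q)) (alt-even q))

expected-total : ∀ q →
  (alt ((suc (2 ℕ.* q) ∸ 1) ℕ./ 2) + + 1) ℚ./ 2 ≡ toℚ (Σ< (suc (2 ℕ.* q)) wave)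
expected-total q = begin
  (alt ((2 ℕ.* q) ℕ./ 2) + + 1) ℚ./ 2    ≡⟨ cong (λ m → (alt m + + 1) ℚ./ 2) halve ⟩
  (alt q + + 1) ℚ./ 2                    ≡⟨ cong (λ z → z ℚ./ 2) (wave-sum q) ⟨
  (+ 2 * Σ< (suc (2 ℕ.* q)) wave) ℚ./ 2  ≡⟨ toℚ-half (Σ< (suc (2 ℕ.* q)) wave) ⟩
  toℚ (Σ< (suc (2 ℕ.* q)) wave)          ∎
  where
  halve : (2 ℕ.* q) ℕ./ 2 ≡ q
  halve = trans (cong (ℕ._/ 2) (ℕP.*-comm 2 q)) (m*n/n≡m q 2)

even-or-odd : ∀ n → ∃ λ q → n ≡ 2 ℕ.* q ⊎ n ≡ suc (2 ℕ.* q)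
even-or-odd zero = 0 , inj₁ refl
even-or-odd (suc n) with even-or-odd n
... | q , inj₁ n≡2q   = q , inj₂ (cong suc n≡2q)
... | q , inj₂ n≡2q+1 = suc q , inj₁ (trans (cong suc n≡2q+1) (sym (ℕP.*-suc 2 q)))

odd-prime : ∀ {p} → Prime p → 2 < p → ∃ λ q → p ≡ suc (2 ℕ.* q)
odd-prime {p} p-prime 2<p with even-or-odd p
... | q , inj₂ p≡2q+1 = q , p≡2q+1
... | q , inj₁ p≡2q with prime⇒irreducible p-prime (subst (2 ℕD.∣_) (sym p≡2q) (ℕD.m∣m*n q))
...   | inj₁ ()
...   | inj₂ 2≡p = contradiction 2≡p (ℕP.<⇒≢ 2<p)

-- Main theorem: p = 2q+1 is odd, and both claims are the integer congruences
-- column-mod and total-mod, transported to ℤ_(p) and compared with the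
-- expected values.  (The column claim holds for j = 0 as well.)
theorem3 : (p : ℕ) → Prime p → 5 ≤ p →
    ((j : ℕ) → 0 < j → j < p →
      toℚ (Σ< p (λ k → T k (+ j)))
        ≡ ((((-[1+ 0 ] ℤ.^ j) ℤ.+ + 1) ℤ.* (-[1+ 0 ] ℤ.^ ((p ∸ j ∸ 1) ℕ./ 2))) ℚ./ 2)
        [modℚ p ])
    × (toℚ (Σ< p (λ m → Σ< p (λ n → T m (+ n))))
        ≡ (((-[1+ 0 ] ℤ.^ ((p ∸ 1) ℕ./ 2)) ℤ.+ + 1) ℚ./ 2)
        [modℚ p ])
theorem3 p p-prime 5≤p with odd-prime p-prime (ℕP.≤-trans (s≤s (s≤s (s≤s z≤n))) 5≤p)
... | q , refl = columns , total
  where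
  P = suc (2 ℕ.* q)
  1<P : 1 < P
  1<P = ℕP.≤-trans (s≤s (s≤s z≤n)) 5≤p
  columns : ∀ j → 0 < j → j < P →
    toℚ (column P j) ≡ ((alt j + + 1) * alt ((P ∸ j ∸ 1) ℕ./ 2)) ℚ./ 2 [modℚ P ]
  columns j _ j<P = subst (λ r → toℚ (column P j) ≡ r [modℚ P ])
    (sym (expected-column q j (ℕP.≤-pred j<P)))
    (toℚ-congruence 1<P (column-mod p-prime (ℕP.≤-pred j<P)))
  total : toℚ (Σ< P (λ m → Σ< P (λ n → T m (+ n)))) ≡ (alt ((P ∸ 1) ℕ./ 2) + + 1) ℚ./ 2 [modℚ P ]
  total = subst (λ r → toℚ (Σ< P (λ m → Σ< P (λ n → T m (+ n)))) ≡ r [modℚ P ])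
    (sym (expected-total q))
    (toℚ-congruence 1<P (total-mod p-prime))
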